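{- Let $t$ be a positive integer and let $G$ be a graph containing no copy of $K_{t,t}$. Then the comparability graph of the poset $P(G)$ has an induced subgraph that contains no copy of $K_{t,t}$ and has at least $e(G)/2$ edges.
   Context: For a graph $G$, $P(G)$ is the poset with ground set $V(G)\times\{0,1\}$ in which the only strict relations are $(u,0)\prec(v,1)$ whenever $u=v$ or $uv\in E(G)$. The comparability graph of a poset has its elements as vertices, two adjacent iff they are comparable. $e(G)$ is the number of edges of $G$; "contains no copy of $K_{t,t}$" means no (not necessarily induced) subgraph isomorphic to $K_{t,t}$. -}

module Defs where

open import Data.Nat using (ℕ; _<ᵇ_; _+_; _≤_; _*_)
open import Data.Bool using (Bool; true; false; _∧_; _∨_; if_then_else_)
open import Data.Fin using (Fin; toℕ; splitAt; _≟_)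
open import Data.List using (List; allFin; map)
open import Data.Nat.ListAction using (sum)
open import Data.Sum using (inj₁; inj₂)
open import Data.Product using (Σ; _×_; _,_)
open import Function.Definitions using (Injective)
open import Relation.Binary.PropositionalEquality using (_≡_; _≢_)
open import Relation.Nullary using (¬_; does)

record Graph (n : ℕ) : Set where
  field
    adj    : Fin n → Fin n → Bool
    sym    : ∀ u v → adj u v ≡ adj v u
    irrefl : ∀ u → adj u u ≡ false
open Graph public

edgeCount : (m : ℕ) → (Fin m → Fin m → Bool) → ℕ
edgeCount m R =
  sum (map (λ i → sum (map (λ j → if (toℕ i <ᵇ toℕ j) ∧ R i j then 1 else 0)
                            (allFin m)))
           (allFin m))

e : ∀ {n} → Graph n → ℕ
e {n} G = edgeCount n (adj G)

ContainsKtt : (t m : ℕ) → (Fin m → Fin m → Bool) → Set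
ContainsKtt t m R =
  Σ (Fin t → Fin m) λ a → Σ (Fin t → Fin m) λ b →
    Injective _≡_ _≡_ a × Injective _≡_ _≡_ b ×
    (∀ i j → a i ≢ b j) × (∀ i j → R (a i) (b j) ≡ true)

induced : ∀ {m} → (Fin m → Fin m → Bool) → (Fin m → Bool) → Fin m → Fin m → Bool
induced R S x y = S x ∧ S y ∧ R x y

-- The poset P(G): ground set V(G) × {0,1}, encoded as Fin (n + n), where
-- splitAt gives inj₁ u ↦ (u,0) and inj₂ u ↦ (u,1).
-- Strict relation: (u,0) ≺ (v,1) iff u = v or uv ∈ E(G); nothing else.
Pprec : ∀ {n} → Graph n → Fin (n + n) → Fin (n + n) → Bool
Pprec {n} G x y with splitAt n x | splitAt n y
... | inj₁ u | inj₂ v = does (u ≟ v) ∨ adj G u v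
... | _      | _      = false

Comp : ∀ {n} → Graph n → Fin (n + n) → Fin (n + n) → Bool
Comp G x y = Pprec G x y ∨ Pprec G y x

-- Take a cut (A, V ∖ A) of G containing at least half of its edges; it is built by adding
-- the vertices one at a time, each on the side opposite to most of its neighbours among
-- the vertices already placed. Let S = A × {0} ∪ (V ∖ A) × {1}. A cut edge uv with u ∈ A
-- gives the comparable pair (u,0) ≺ (v,1) inside S, so the comparability graph induced
-- on S has at least e(G)/2 edges. All its edges join the two levels, so for t ≥ 1 a copy
-- of K_{t,t} in it has one side in A × {0} and the other in (V ∖ A) × {1}; forgetting the
-- levels gives a copy of K_{t,t} in G, whose sides are disjoint because A and V ∖ A are.
module Submission where

open import Defs hiding (sym)
open import Data.Nat using (ℕ; zero; suc; _+_; _*_; _≤_; _<ᵇ_; z≤n)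
open import Data.Nat.Properties
  using (+-0-commutativeMonoid; +-identityʳ; *-distribˡ-+; ≤-refl; ≤-reflexive; ≤-trans; ≤-total;
         +-mono-≤; +-monoˡ-≤; +-monoʳ-≤; *-monoʳ-≤; m≤m+n; m≤n+m; <-≤-trans; <⇒<ᵇ; module ≤-Reasoning)
open import Data.Bool using (Bool; true; false; not; _∧_; _∨_; _xor_; if_then_else_)
open import Data.Bool.Properties using (T-≡; ∨-zeroʳ; not-¬)
open import Data.Fin using (Fin; zero; suc; toℕ; _↑ˡ_; _↑ʳ_; splitAt; _≟_)
open import Data.Fin.Properties
  using (toℕ-↑ˡ; toℕ-↑ʳ; toℕ<n; splitAt-↑ˡ; splitAt-↑ʳ; splitAt⁻¹-↑ˡ; splitAt⁻¹-↑ʳ)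
open import Data.List using (map; tabulate; allFin)
open import Data.Nat.ListAction using (sum)
open import Data.Vec.Functional using (_∷_)
open import Data.Product using (Σ; ∃; _,_; _×_; proj₁; proj₂)
open import Data.Sum using (_⊎_; inj₁; inj₂; [_,_]′; swap)
open import Data.Empty using (⊥; ⊥-elim)
open import Function using (_∘_; id)
open import Function.Bundles using (Equivalence)
open import Function.Definitions using (Injective)
open import Relation.Nullary using (¬_; does)
open import Relation.Nullary.Decidable using (dec-false)
open import Relation.Binary.PropositionalEquality
  using (_≡_; _≢_; refl; sym; trans; cong; cong₂; subst; module ≡-Reasoning)
open import Algebra.Properties.CommutativeMonoid.Sum +-0-commutativeMonoid
  using (sum-syntax; sum-cong-≗; ∑-distrib-+; ∑-comm)
  renaming (sum to ∑)

⟦_⟧ : Bool → ℕ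
⟦ b ⟧ = if b then 1 else 0

∑-mono-≤ : ∀ {m} {f g : Fin m → ℕ} → (∀ i → f i ≤ g i) → ∑ f ≤ ∑ g
∑-mono-≤ {zero}  f≤g = z≤n
∑-mono-≤ {suc m} f≤g = +-mono-≤ (f≤g zero) (∑-mono-≤ (f≤g ∘ suc))

∑-↑ˡ-≤ : ∀ {m} k (f : Fin (m + k) → ℕ) → ∑[ i < m ] f (i ↑ˡ k) ≤ ∑ f
∑-↑ˡ-≤ {zero}  k f = z≤n
∑-↑ˡ-≤ {suc m} k f = +-monoʳ-≤ (f zero) (∑-↑ˡ-≤ k (f ∘ suc))

∑-↑ʳ-≤ : ∀ m {k} (f : Fin (m + k) → ℕ) → ∑[ j < k ] f (m ↑ʳ j) ≤ ∑ f
∑-↑ʳ-≤ zero    f = ≤-refl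
∑-↑ʳ-≤ (suc m) f = ≤-trans (∑-↑ʳ-≤ m (f ∘ suc)) (m≤n+m _ (f zero))

∑∑-distrib-+ : ∀ {m k} (f g : Fin m → Fin k → ℕ) →
  ∑[ i < m ] ∑[ j < k ] (f i j + g i j) ≡ ∑[ i < m ] ∑[ j < k ] f i j + ∑[ i < m ] ∑[ j < k ] g i j
∑∑-distrib-+ f g =
  trans (sum-cong-≗ (λ i → ∑-distrib-+ (f i) (g i))) (∑-distrib-+ (λ i → ∑ (f i)) (λ i → ∑ (g i)))

sum-map-tabulate : ∀ {A : Set} {m} (f : A → ℕ) (g : Fin m → A) → sum (map f (tabulate g)) ≡ ∑ (f ∘ g)
sum-map-tabulate {m = zero}  f g = refl
sum-map-tabulate {m = suc m} f g = cong (f (g zero) +_) (sum-map-tabulate f (g ∘ suc))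

edgeCount-∑ : ∀ m (R : Fin m → Fin m → Bool) →
  edgeCount m R ≡ ∑[ i < m ] ∑[ j < m ] ⟦ (toℕ i <ᵇ toℕ j) ∧ R i j ⟧
edgeCount-∑ m R =
  trans (sum-map-tabulate (λ i → sum (map (λ j → ⟦ (toℕ i <ᵇ toℕ j) ∧ R i j ⟧) (allFin m))) id)
        (sum-cong-≗ (λ i → sum-map-tabulate (λ j → ⟦ (toℕ i <ᵇ toℕ j) ∧ R i j ⟧) id))

edgeCount-suc : ∀ m (R : Fin (suc m) → Fin (suc m) → Bool) →
  edgeCount (suc m) R ≡ ∑[ j < m ] ⟦ R zero (suc j) ⟧ + edgeCount m (λ i j → R (suc i) (suc j))
edgeCount-suc m R =
  trans (edgeCount-∑ (suc m) R) (cong (∑[ j < m ] ⟦ R zero (suc j) ⟧ +_) (sym (edgeCount-∑ m _)))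

⟦⟧-split : ∀ a x → ⟦ x ⟧ ≡ ⟦ not a ∧ x ⟧ + ⟦ a ∧ x ⟧
⟦⟧-split true  x = refl
⟦⟧-split false x = sym (+-identityʳ ⟦ x ⟧)

⟦⟧-exclusive : ∀ a b x → a ∧ b ≡ false → ⟦ a ∧ x ⟧ + ⟦ b ∧ x ⟧ ≤ ⟦ x ⟧
⟦⟧-exclusive true  true  x ()
⟦⟧-exclusive true  false x _ = ≤-reflexive (+-identityʳ ⟦ x ⟧)
⟦⟧-exclusive false true  x _ = ≤-refl
⟦⟧-exclusive false false x _ = z≤n

<ᵇ-asym : ∀ m n → (m <ᵇ n) ∧ (n <ᵇ m) ≡ false
<ᵇ-asym zero    zero    = refl
<ᵇ-asym zero    (suc n) = refl
<ᵇ-asym (suc m) zero    = refl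
<ᵇ-asym (suc m) (suc n) = <ᵇ-asym m n

∧-true : ∀ {a b} → a ∧ b ≡ true → a ≡ true × b ≡ true
∧-true {true} b≡true = refl , b≡true

∨-true : ∀ {a b} → a ∨ b ≡ true → a ≡ true ⊎ b ≡ true
∨-true {true}  _      = inj₁ refl
∨-true {false} b≡true = inj₂ b≡true

induced-true : ∀ {m} {R : Fin m → Fin m → Bool} {S : Fin m → Bool} {x y} →
  induced R S x y ≡ true → S x ≡ true × S y ≡ true × R x y ≡ true
induced-true {S = S} {x} {y} x~y with ∧-true {S x} x~y
... | x∈S , rest = x∈S , ∧-true {S y} rest

crossing : ∀ {m} → (Fin m → Bool) → (Fin m → Fin m → Bool) → Fin m → Fin m → Bool
crossing A R i j = (A i xor A j) ∧ R i j

larger-half : (f : Bool → ℕ) → ∃ λ b → f true + f false ≤ 2 * f b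
larger-half f with ≤-total (f false) (f true)
... | inj₁ f₀≤f₁ = true  , ≤-trans (+-monoʳ-≤ (f true) f₀≤f₁)
                                   (≤-reflexive (cong (f true +_) (sym (+-identityʳ (f true)))))
... | inj₂ f₁≤f₀ = false , ≤-trans (+-monoˡ-≤ (f false) f₁≤f₀)
                                   (≤-reflexive (cong (f false +_) (sym (+-identityʳ (f false)))))

half-cut : ∀ m (R : Fin m → Fin m → Bool) → ∃ λ A → edgeCount m R ≤ 2 * edgeCount m (crossing A R)
half-cut zero    R = (λ ()) , z≤n
half-cut (suc m) R with half-cut m (λ i j → R (suc i) (suc j))
... | A , e≤2c with larger-half (λ b → ∑[ j < m ] ⟦ (b xor A j) ∧ R zero (suc j) ⟧)
... | b , d≤2c = b ∷ A , (begin
  edgeCount (suc m) R                            ≡⟨ edgeCount-suc m R ⟩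
  ∑[ j < m ] ⟦ R zero (suc j) ⟧ + edgeCount m R′  ≡⟨ cong (_+ edgeCount m R′) degree-split ⟩
  cross true + cross false + edgeCount m R′      ≤⟨ +-mono-≤ d≤2c e≤2c ⟩
  2 * cross b + 2 * edgeCount m (crossing A R′)  ≡⟨ sym (*-distribˡ-+ 2 (cross b) _) ⟩
  2 * (cross b + edgeCount m (crossing A R′))    ≡⟨ cong (2 *_) (sym (edgeCount-suc m (crossing (b ∷ A) R))) ⟩
  2 * edgeCount (suc m) (crossing (b ∷ A) R)     ∎)
  where
  open ≤-Reasoning
  R′ : Fin m → Fin m → Bool
  R′ i j = R (suc i) (suc j)
  cross : Bool → ℕ
  cross b = ∑[ j < m ] ⟦ (b xor A j) ∧ R zero (suc j) ⟧
  degree-split : ∑[ j < m ] ⟦ R zero (suc j) ⟧ ≡ cross true + cross false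
  degree-split = trans (sum-cong-≗ (λ j → ⟦⟧-split (A j) (R zero (suc j))))
                       (∑-distrib-+ (λ j → ⟦ not (A j) ∧ R zero (suc j) ⟧) (λ j → ⟦ A j ∧ R zero (suc j) ⟧))

directedCut : ∀ {m} → (Fin m → Bool) → (Fin m → Fin m → Bool) → ℕ
directedCut {m} A R = ∑[ i < m ] ∑[ j < m ] ⟦ A i ∧ not (A j) ∧ R i j ⟧

crossing≤directedCut : ∀ {m} (A : Fin m → Bool) (R : Fin m → Fin m → Bool) → (∀ i j → R i j ≡ R j i) →
  edgeCount m (crossing A R) ≤ directedCut A R
crossing≤directedCut {m} A R R-sym = begin
  edgeCount m (crossing A R)
    ≡⟨ edgeCount-∑ m (crossing A R) ⟩
  ∑[ i < m ] ∑[ j < m ] ⟦ lt i j ∧ crossing A R i j ⟧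
    ≡⟨ sum-cong-≗ (λ i → sum-cong-≗ (λ j → orient-crossing i j (lt i j))) ⟩
  ∑[ i < m ] ∑[ j < m ] (⟦ lt i j ∧ h i j ⟧ + ⟦ lt i j ∧ h j i ⟧)
    ≡⟨ ∑∑-distrib-+ (λ i j → ⟦ lt i j ∧ h i j ⟧) (λ i j → ⟦ lt i j ∧ h j i ⟧) ⟩
  ∑[ i < m ] ∑[ j < m ] ⟦ lt i j ∧ h i j ⟧ + ∑[ i < m ] ∑[ j < m ] ⟦ lt i j ∧ h j i ⟧
    ≡⟨ cong (∑[ i < m ] ∑[ j < m ] ⟦ lt i j ∧ h i j ⟧ +_) (∑-comm (λ j i → ⟦ lt j i ∧ h i j ⟧)) ⟩
  ∑[ i < m ] ∑[ j < m ] ⟦ lt i j ∧ h i j ⟧ + ∑[ i < m ] ∑[ j < m ] ⟦ lt j i ∧ h i j ⟧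
    ≡⟨ sym (∑∑-distrib-+ (λ i j → ⟦ lt i j ∧ h i j ⟧) (λ i j → ⟦ lt j i ∧ h i j ⟧)) ⟩
  ∑[ i < m ] ∑[ j < m ] (⟦ lt i j ∧ h i j ⟧ + ⟦ lt j i ∧ h i j ⟧)
    ≤⟨ ∑-mono-≤ (λ i → ∑-mono-≤ (λ j → ⟦⟧-exclusive (lt i j) (lt j i) (h i j) (<ᵇ-asym (toℕ i) (toℕ j)))) ⟩
  directedCut A R ∎
  where
  open ≤-Reasoning
  lt : Fin m → Fin m → Bool
  lt i j = toℕ i <ᵇ toℕ j
  h : Fin m → Fin m → Bool
  h i j = A i ∧ not (A j) ∧ R i j
  orient-crossing : ∀ i j l → ⟦ l ∧ crossing A R i j ⟧ ≡ ⟦ l ∧ h i j ⟧ + ⟦ l ∧ h j i ⟧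
  orient-crossing i j false = refl
  orient-crossing i j true rewrite R-sym j i with A i | A j
  ... | true  | true  = refl
  ... | true  | false = sym (+-identityʳ _)
  ... | false | true  = refl
  ... | false | false = refl

module _ {X : Set} {_≺_ : X → X → Set} {Low High : X → Set}
         (low≢high : ∀ {x} → Low x → High x → ⊥)
         (graded : ∀ {x y} → x ≺ y → Low x × High y) where

  below-if-low : ∀ {t} (a b : Fin (suc t) → X) → (∀ i j → a i ≺ b j ⊎ b j ≺ a i) →
    Low (a zero) → ∀ i j → a i ≺ b j
  below-if-low a b comparable a₀-low i j =
    [ id , (λ bⱼ≺aᵢ → ⊥-elim (low≢high (proj₁ (graded bⱼ≺aᵢ)) (b-high j))) ]′ (comparable i j)
    where
    b-high : ∀ j → High (b j)
    b-high j = [ (λ a₀≺bⱼ → proj₂ (graded a₀≺bⱼ))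
               , (λ bⱼ≺a₀ → ⊥-elim (low≢high a₀-low (proj₂ (graded bⱼ≺a₀)))) ]′ (comparable zero j)

  orient : ∀ {t} (a b : Fin (suc t) → X) → (∀ i j → a i ≺ b j ⊎ b j ≺ a i) →
    (∀ i j → a i ≺ b j) ⊎ (∀ i j → b j ≺ a i)
  orient a b comparable with comparable zero zero
  ... | inj₁ a₀≺b₀ = inj₁ (below-if-low a b comparable (proj₁ (graded a₀≺b₀)))
  ... | inj₂ b₀≺a₀ =
    inj₂ (λ i j → below-if-low b a (λ j i → swap (comparable i j)) (proj₁ (graded b₀≺a₀)) j i)

↑ˡ<ᵇ↑ʳ : ∀ {m k} (u : Fin m) (v : Fin k) → (toℕ (u ↑ˡ k) <ᵇ toℕ (m ↑ʳ v)) ≡ true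
↑ˡ<ᵇ↑ʳ {m} {k} u v rewrite toℕ-↑ˡ u k | toℕ-↑ʳ m v =
  Equivalence.to T-≡ (<⇒<ᵇ (<-≤-trans (toℕ<n u) (m≤m+n m (toℕ v))))

module _ {n : ℕ} where

  vertex : Fin (n + n) → Fin n
  vertex x = [ id , id ]′ (splitAt n x)

  Lower Upper : Fin (n + n) → Set
  Lower x = vertex x ↑ˡ n ≡ x
  Upper x = n ↑ʳ vertex x ≡ x

  lower≢upper : ∀ {x} → Lower x → Upper x → ⊥
  lower≢upper {x} x-lower x-upper
    with trans (sym (splitAt-↑ˡ n (vertex x) n))
               (trans (cong (splitAt n) (trans x-lower (sym x-upper))) (splitAt-↑ʳ n n (vertex x)))
  ... | ()

  cutSet : (Fin n → Bool) → Fin (n + n) → Bool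
  cutSet A x = [ A , not ∘ A ]′ (splitAt n x)

  cutSet-↑ˡ : ∀ A u → cutSet A (u ↑ˡ n) ≡ A u
  cutSet-↑ˡ A u rewrite splitAt-↑ˡ n u n = refl

  cutSet-↑ʳ : ∀ A v → cutSet A (n ↑ʳ v) ≡ not (A v)
  cutSet-↑ʳ A v rewrite splitAt-↑ʳ n n v = refl

  module _ (G : Graph n) where

    Pprec-↑ : ∀ u v → Pprec G (u ↑ˡ n) (n ↑ʳ v) ≡ does (u ≟ v) ∨ adj G u v
    Pprec-↑ u v rewrite splitAt-↑ˡ n u n | splitAt-↑ʳ n n v = refl

    Pprec-graded : ∀ {x y} → Pprec G x y ≡ true → Lower x × Upper y
    Pprec-graded {x} {y} x≺y with splitAt n x in ex | splitAt n y in ey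
    Pprec-graded x≺y | inj₁ u | inj₂ v = splitAt⁻¹-↑ˡ ex , splitAt⁻¹-↑ʳ ey
    Pprec-graded ()  | inj₁ _ | inj₁ _
    Pprec-graded ()  | inj₂ _ | _

    cut-edge-in-cutSet : ∀ A u v →
      ⟦ A u ∧ not (A v) ∧ adj G u v ⟧ ≤
      ⟦ (toℕ (u ↑ˡ n) <ᵇ toℕ (n ↑ʳ v)) ∧ induced (Comp G) (cutSet A) (u ↑ˡ n) (n ↑ʳ v) ⟧
    cut-edge-in-cutSet A u v
      rewrite ↑ˡ<ᵇ↑ʳ u v | splitAt-↑ˡ n u n | splitAt-↑ʳ n n v
      with A u | A v | adj G u v
    ... | true  | false | true  rewrite ∨-zeroʳ (does (u ≟ v)) = ≤-refl
    ... | true  | false | false = z≤n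
    ... | true  | true  | _     = z≤n
    ... | false | _     | _     = z≤n

    directedCut≤edgeCount : ∀ A → directedCut A (adj G) ≤ edgeCount (n + n) (induced (Comp G) (cutSet A))
    directedCut≤edgeCount A = begin
      directedCut A (adj G)                            ≤⟨ ∑-mono-≤ (λ u → ∑-mono-≤ (cut-edge-in-cutSet A u)) ⟩
      ∑[ u < n ] ∑[ v < n ] F (u ↑ˡ n) (n ↑ʳ v)        ≤⟨ ∑-mono-≤ (λ u → ∑-↑ʳ-≤ n (F (u ↑ˡ n))) ⟩
      ∑[ u < n ] ∑[ y < n + n ] F (u ↑ˡ n) y           ≤⟨ ∑-↑ˡ-≤ n (λ x → ∑ (F x)) ⟩
      ∑[ x < n + n ] ∑[ y < n + n ] F x y              ≡⟨ sym (edgeCount-∑ (n + n) _) ⟩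
      edgeCount (n + n) (induced (Comp G) (cutSet A))  ∎
      where
      open ≤-Reasoning
      F : Fin (n + n) → Fin (n + n) → ℕ
      F x y = ⟦ (toℕ x <ᵇ toℕ y) ∧ induced (Comp G) (cutSet A) x y ⟧

    oriented-pullback : ∀ A {t} (a b : Fin (suc t) → Fin (n + n)) →
      Injective _≡_ _≡_ a → Injective _≡_ _≡_ b →
      (∀ i → cutSet A (a i) ≡ true) → (∀ j → cutSet A (b j) ≡ true) →
      (∀ i j → Pprec G (a i) (b j) ≡ true) → ContainsKtt (suc t) n (adj G)
    oriented-pullback A a b a-inj b-inj a∈S b∈S a≺b =
      vertex ∘ a , vertex ∘ b , a′-inj , b′-inj , a′≢b′ , a′~b′
      where
      a-lower : ∀ i → Lower (a i)
      a-lower i = proj₁ (Pprec-graded (a≺b i zero))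
      b-upper : ∀ j → Upper (b j)
      b-upper j = proj₂ (Pprec-graded (a≺b zero j))
      a′-inj : Injective _≡_ _≡_ (vertex ∘ a)
      a′-inj {i} {i′} eq = a-inj (trans (sym (a-lower i)) (trans (cong (_↑ˡ n) eq) (a-lower i′)))
      b′-inj : Injective _≡_ _≡_ (vertex ∘ b)
      b′-inj {j} {j′} eq = b-inj (trans (sym (b-upper j)) (trans (cong (n ↑ʳ_) eq) (b-upper j′)))
      a′∈A : ∀ i → A (vertex (a i)) ≡ true
      a′∈A i = trans (sym (cutSet-↑ˡ A (vertex (a i))))
                     (subst (λ x → cutSet A x ≡ true) (sym (a-lower i)) (a∈S i))
      b′∉A : ∀ j → not (A (vertex (b j))) ≡ true
      b′∉A j = trans (sym (cutSet-↑ʳ A (vertex (b j))))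
                     (subst (λ y → cutSet A y ≡ true) (sym (b-upper j)) (b∈S j))
      a′≢b′ : ∀ i j → vertex (a i) ≢ vertex (b j)
      a′≢b′ i j eq = not-¬ (cong A eq) (trans (a′∈A i) (sym (b′∉A j)))
      a′~b′ : ∀ i j → adj G (vertex (a i)) (vertex (b j)) ≡ true
      a′~b′ i j = begin
        adj G u v                  ≡⟨ cong (_∨ adj G u v) (sym (dec-false (u ≟ v) (a′≢b′ i j))) ⟩
        does (u ≟ v) ∨ adj G u v   ≡⟨ sym (Pprec-↑ u v) ⟩
        Pprec G (u ↑ˡ n) (n ↑ʳ v)  ≡⟨ cong₂ (Pprec G) (a-lower i) (b-upper j) ⟩
        Pprec G (a i) (b j)        ≡⟨ a≺b i j ⟩
        true                       ∎
        where
        open ≡-Reasoning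
        u = vertex (a i)
        v = vertex (b j)

    cutSet-Ktt-free : ∀ A t → 1 ≤ t → ¬ ContainsKtt t n (adj G) →
      ¬ ContainsKtt t (n + n) (induced (Comp G) (cutSet A))
    cutSet-Ktt-free A zero    ()
    cutSet-Ktt-free A (suc t) _ no-Ktt (a , b , a-inj , b-inj , _ , a~b) =
      [ (λ a≺b → no-Ktt (oriented-pullback A a b a-inj b-inj a∈S b∈S a≺b))
      , (λ b≺a → no-Ktt (oriented-pullback A b a b-inj a-inj b∈S a∈S (λ j i → b≺a i j))) ]′
        (orient {_≺_ = λ x y → Pprec G x y ≡ true} lower≢upper Pprec-graded a b comparable)
      where
      parts : ∀ i j → cutSet A (a i) ≡ true × cutSet A (b j) ≡ true × Comp G (a i) (b j) ≡ true
      parts i j = induced-true {R = Comp G} {S = cutSet A} (a~b i j)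
      a∈S : ∀ i → cutSet A (a i) ≡ true
      a∈S i = proj₁ (parts i zero)
      b∈S : ∀ j → cutSet A (b j) ≡ true
      b∈S j = proj₁ (proj₂ (parts zero j))
      comparable : ∀ i j → Pprec G (a i) (b j) ≡ true ⊎ Pprec G (b j) (a i) ≡ true
      comparable i j = ∨-true (proj₂ (proj₂ (parts i j)))

claim7 : (t : ℕ) → 1 ≤ t → (n : ℕ) → (G : Graph n) → ¬ ContainsKtt t n (adj G) →
    Σ (Fin (n + n) → Bool) λ S →
      (¬ ContainsKtt t (n + n) (induced (Comp G) S)) ×
      (e G ≤ 2 * edgeCount (n + n) (induced (Comp G) S))
claim7 t 1≤t n G no-Ktt with half-cut n (adj G)
... | A , e≤2cut = cutSet A , cutSet-Ktt-free G A t 1≤t no-Ktt , (begin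
  e G                                                  ≤⟨ e≤2cut ⟩
  2 * edgeCount n (crossing A (adj G))                 ≤⟨ *-monoʳ-≤ 2 (crossing≤directedCut A (adj G) (Graph.sym G)) ⟩
  2 * directedCut A (adj G)                            ≤⟨ *-monoʳ-≤ 2 (directedCut≤edgeCount G A) ⟩
  2 * edgeCount (n + n) (induced (Comp G) (cutSet A))  ∎)
  where open ≤-Reasoning
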